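{- For any finite, simple, undirected, connected graphs $G$ and $H$, $${\rm dmg}(G\square H)\le \max\big\{{\rm dmg}(G)\,|V(H)|,\ ({\rm dmg}(H)+1)\,|V(G)|\big\}.$$
   Context: The Cartesian product $G\square H$ has vertex set $V(G)\times V(H)$, with $(u,v)\sim(u',v')$ iff ($u=u'$ and $vv'\in E(H)$) or ($v=v'$ and $uu'\in E(G)$). Damage game on a graph: one cop and one robber; in round $0$ the cop chooses a vertex, then the robber does; in each later round the cop moves to an adjacent vertex or passes, then the robber moves to an adjacent vertex or passes; the robber is captured if the cop occupies the robber's vertex. A vertex $v$ is damaged if the robber occupies $v$ in some round $i\ge0$ and in round $i+1$ the uncaptured robber passes or moves to a neighbour. The damage number ${\rm dmg}(\cdot)$ is the number of distinct vertices damaged when the cop plays to minimize and the robber to maximize this number. -}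

module Defs where

open import Level using (0ℓ)
open import Data.Nat using (ℕ; zero; suc; _≤_; _+_; _*_; _⊔_)
open import Data.Fin using (Fin)
open import Data.Fin.Properties using (*↔×)
open import Data.Product using (Σ; ∃; ∃-syntax; _×_; _,_)
open import Data.Product.Function.NonDependent.Propositional using (_×-↔_)
open import Data.Sum using (_⊎_; inj₁; inj₂)
open import Data.List using (List; []; _∷_; _∷ʳ_; applyUpTo; length)
open import Data.List.Relation.Unary.All using (All)
open import Data.List.Relation.Unary.Unique.Propositional using (Unique)
open import Function.Bundles using (_↔_)
open import Function.Properties.Inverse using (↔-trans)
open import Relation.Nullary using (¬_)
open import Relation.Binary.PropositionalEquality using (_≡_; _≢_; refl; sym)
open import Relation.Binary.Construct.Closure.ReflexiveTransitive using (Star)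

record Graph : Set₁ where
  field
    V      : Set
    _~_    : V → V → Set
    ~-sym  : ∀ {u v} → u ~ v → v ~ u
    ~-irr  : ∀ {v} → ¬ (v ~ v)
    order  : ℕ
    enum   : Fin order ↔ V

open Graph public

Connected : Graph → Set
Connected G = V G × (∀ u v → Star (_~_ G) u v)

_□_ : Graph → Graph → Graph
G □ H = record
  { V     = V G × V H
  ; _~_   = λ { (u , v) (u′ , v′) →
               (u ≡ u′ × _~_ H v v′) ⊎ (v ≡ v′ × _~_ G u u′) }
  ; ~-sym = λ { (inj₁ (refl , e)) → inj₁ (refl , ~-sym H e)
              ; (inj₂ (refl , e)) → inj₂ (refl , ~-sym G e) }
  ; ~-irr = λ { (inj₁ (_ , e)) → ~-irr H e
              ; (inj₂ (_ , e)) → ~-irr G e }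
  ; order = order G * order H
  ; enum  = ↔-trans *↔× (enum G ×-↔ enum H)
  }

module Game (G : Graph) where

  Step : V G → V G → Set
  Step u v = u ≡ v ⊎ _~_ G u v

  -- A cop strategy maps the robber's past positions r₀ … r_{i-1} to the
  -- cop's position in round i (round 0: empty history); moves are legal.
  record CopStrategy : Set where
    field
      play  : List (V G) → V G
      legal : ∀ h x → Step (play h) (play (h ∷ʳ x))

  -- A robber play: positions r i in rounds i = 0,1,2,…, moves legal.
  -- (Against a fixed deterministic cop strategy, robber strategies
  --  amount to such sequences.)
  record RobberPlay : Set where
    field
      pos   : ℕ → V G
      legal : ∀ i → Step (pos i) (pos (suc i))

  module _ (σ : CopStrategy) (ρ : RobberPlay) where
    open CopStrategy σ renaming (play to s)
    open RobberPlay ρ renaming (pos to r)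

    cop : ℕ → V G
    cop i = s (applyUpTo r i)

    -- in round i the robber is not captured (cop ≠ robber after the
    -- robber's move), and in round i+1 the cop's move does not capture it
    Safe : ℕ → Set
    Safe i = cop i ≢ r i × cop (suc i) ≢ r i

    Damaged : V G → Set
    Damaged v = ∃[ i ] (r i ≡ v × (∀ j → j ≤ i → Safe j))

  CopGuarantees : ℕ → Set
  CopGuarantees k =
    Σ CopStrategy λ σ → ∀ (ρ : RobberPlay) (l : List (V G)) →
      Unique l → All (Damaged σ ρ) l → length l ≤ k

IsDmg : Graph → ℕ → Set
IsDmg G k = CopGuarantees k × (∀ j → CopGuarantees j → k ≤ j)
  where open Game G

-- Let the cop on G □ H play a G-strategy against the G-coordinates of the robber's moves that are not
-- H-moves (moves changing only the H-coordinate), and an H-strategy against the H-coordinates of its H-moves.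
-- These two shadow robbers walk legally in G and H, and once a factor strategy captures its shadow robber we
-- let it follow that robber, which costs no damage. Let τ be the last round in which a damaged vertex is
-- occupied. If the G-shadow is not caught by round τ, the G-coordinate of every damaged vertex is damaged in the
-- G-game, so at most dmg(G)·|V(H)| vertices are damaged. Otherwise the H-shadow is not caught, since captures in
-- both factors put the product cop on the robber; then every damaged vertex has an H-coordinate that is damaged
-- in the H-game or is the robber's initial one, so at most (dmg(H)+1)·|V(G)| are damaged. Following a robber
-- needs decidable adjacency, which a finite graph has only up to double negation; this suffices because the
-- conclusion is a decidable inequality.

module Submission where

open import Defs
open import Data.Nat
  using (ℕ; zero; suc; _≤_; _<_; _+_; _*_; _⊔_; z≤n; s≤s; _≤′_; ≤′-refl; ≤′-step; _≤?_)
open import Data.Nat.Properties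
  using ( ≤-refl; ≤-trans; ≤-total; ≤-pred; ≤-reflexive; <-≤-trans; +-comm; *-mono-≤; m<m+n
        ; m≤n⇒m≤1+n; m≤m⊔n; m≤n⊔m; n≮0; ≤⇒≤′; anyUpTo?)
open import Data.Fin using (Fin)
open import Data.Fin.Properties using (sequence; inj⇒≟)
open import Data.Maybe using (Maybe; just; nothing)
open import Data.Product using (Σ; ∃; _×_; _,_; proj₁; proj₂; swap)
open import Data.Sum using (_⊎_; inj₁; inj₂; [_,_]′)
import Data.Sum as Sum
open import Data.Empty using (⊥-elim)
open import Data.List
  using (List; []; _∷_; [_]; _++_; _∷ʳ_; length; map; filter; foldl; applyUpTo; allFin; cartesianProduct; deduplicate)
open import Data.List.Properties
  using (length-++; length-map; length-tabulate; ++-identityʳ; ++-assoc; foldl-∷ʳ; applyUpTo-∷ʳ; filter-all)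
open import Data.List.Relation.Unary.All as All using (All; []; _∷_)
import Data.List.Relation.Unary.All.Properties as All
open import Data.List.Relation.Unary.Any using (here; there; _─_)
open import Data.List.Relation.Unary.AllPairs using ([]; _∷_)
open import Data.List.Relation.Unary.Unique.Propositional using (Unique)
import Data.List.Relation.Unary.Unique.Propositional.Properties as Unique
open import Data.List.Relation.Unary.Unique.DecPropositional.Properties using (deduplicate-!)
open import Data.List.Relation.Unary.Linked using (Linked; []; [-]; _∷_)
open import Data.List.Membership.Propositional using (_∈_)
open import Data.List.Membership.Propositional.Properties
  using ( ∈-map⁺; ∈-map⁻; ∈-allFin; ∈-deduplicate⁺; ∈-deduplicate⁻; ∈-cartesianProduct⁺; ∈-∃++
        ; ∈-++⁺ˡ; ∈-++⁺ʳ)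
open import Effect.Monad using (RawMonad)
open import Function using (_∘_; id; case_of_)
open import Function.Bundles using (_↔_; Inverse)
open import Function.Definitions using (Injective)
open import Function.Properties.Inverse using (↔-sym; ↔⇒↣)
open import Relation.Binary.Definitions using (DecidableEquality; Reflexive)
open import Relation.Binary.PropositionalEquality hiding ([_])
open import Relation.Nullary using (¬_; Dec; yes; no; ¬?; _×-dec_; _⊎-dec_; decidable-stable)
open import Relation.Nullary.Negation using (¬¬-Monad; ¬¬-map)
open import Relation.Nullary.Decidable using (¬¬-excluded-middle)

-- Counting duplicate-free lists

AtMost : {A : Set} → ℕ → (A → Set) → Set
AtMost {A} k P = (xs : List A) → Unique xs → All P xs → length xs ≤ k

module _ {A : Set} where

  length-─ : ∀ {x : A} {ys} (p : x ∈ ys) → length ys ≡ suc (length (ys ─ p))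
  length-─ (here _)  = refl
  length-─ (there p) = cong suc (length-─ p)

  ∈-─ : ∀ {x y : A} {ys} (p : x ∈ ys) → x ≢ y → y ∈ ys → y ∈ (ys ─ p)
  ∈-─ (here refl) x≢y (here refl) = ⊥-elim (x≢y refl)
  ∈-─ (here _)    _   (there q)   = q
  ∈-─ (there _)   _   (here refl) = here refl
  ∈-─ (there p)   x≢y (there q)   = there (∈-─ p x≢y q)

  unique-⊆⇒length≤ : ∀ {xs ys : List A} → Unique xs → All (_∈ ys) xs → length xs ≤ length ys
  unique-⊆⇒length≤ []               []             = z≤n
  unique-⊆⇒length≤ (x∉xs ∷ unique) (x∈ys ∷ xs⊆ys) =
    subst (_ ≤_) (sym (length-─ x∈ys))
      (s≤s (unique-⊆⇒length≤ unique
              (All.zipWith (λ (x≢y , y∈ys) → ∈-─ x∈ys x≢y y∈ys) (x∉xs , xs⊆ys))))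

length-cartesianProduct : ∀ {A B : Set} (xs : List A) (ys : List B) →
  length (cartesianProduct xs ys) ≡ length xs * length ys
length-cartesianProduct []       ys = refl
length-cartesianProduct (x ∷ xs) ys = begin
  length (map (x ,_) ys ++ cartesianProduct xs ys)
    ≡⟨ length-++ (map (x ,_) ys) ⟩
  length (map (x ,_) ys) + length (cartesianProduct xs ys)
    ≡⟨ cong₂ _+_ (length-map (x ,_) ys) (length-cartesianProduct xs ys) ⟩
  length ys + length xs * length ys
    ∎
  where open ≡-Reasoning

AtMost-proj₁ : ∀ {A B : Set} {P : A → Set} {a n} → DecidableEquality A → Fin n ↔ B →
  AtMost a P → AtMost (a * n) (P ∘ proj₁)
AtMost-proj₁ {A} {B} {P} {a} {n} _≟_ Fin↔B bound zs unique Pzs = begin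
  length zs                           ≤⟨ unique-⊆⇒length≤ unique (All.tabulate zs⊆) ⟩
  length (cartesianProduct firsts bs) ≡⟨ length-cartesianProduct firsts bs ⟩
  length firsts * length bs           ≤⟨ *-mono-≤ (bound firsts (deduplicate-! _≟_ _) Pfirsts)
                                                   (≤-reflexive length-bs) ⟩
  a * n                               ∎
  where
  open Data.Nat.Properties.≤-Reasoning
  open Inverse Fin↔B
  firsts : List A
  firsts = deduplicate _≟_ (map proj₁ zs)
  bs : List B
  bs = map to (allFin n)
  length-bs : length bs ≡ n
  length-bs = trans (length-map to (allFin n)) (length-tabulate id)
  Pfirsts : All P firsts
  Pfirsts = All.tabulate λ x∈firsts →
    case ∈-map⁻ proj₁ (∈-deduplicate⁻ _≟_ (map proj₁ zs) x∈firsts) of λ where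
      (z , z∈zs , refl) → All.lookup Pzs z∈zs
  zs⊆ : ∀ {z} → z ∈ zs → z ∈ cartesianProduct firsts bs
  zs⊆ {x , y} z∈zs =
    ∈-cartesianProduct⁺ (∈-deduplicate⁺ _≟_ (∈-map⁺ proj₁ z∈zs))
                        (subst (_∈ bs) (strictlyInverseˡ y) (∈-map⁺ to (∈-allFin (from y))))

AtMost-comap : ∀ {A B : Set} {P : B → Set} {k} (f : A → B) → Injective _≡_ _≡_ f →
  AtMost k P → AtMost k (P ∘ f)
AtMost-comap {k = k} f f-injective bound xs unique Pxs =
  subst (_≤ k) (length-map f xs) (bound (map f xs) (Unique.map⁺ f-injective unique) (All.map⁺ Pxs))

AtMost-proj₂ : ∀ {A B : Set} {P : B → Set} {b n} → DecidableEquality B → Fin n ↔ A →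
  AtMost b P → AtMost (b * n) (P ∘ proj₂ {A = A})
AtMost-proj₂ _≟_ Fin↔A bound = AtMost-comap swap (λ { refl → refl }) (AtMost-proj₁ _≟_ Fin↔A bound)

module _ {A : Set} (_≟_ : DecidableEquality A) (x₀ : A) where

  private
    ≢x₀? : ∀ x → Dec (x ≢ x₀)
    ≢x₀? x = ¬? (x ≟ x₀)

  length≤1+length-filter≢ : ∀ {xs} → Unique xs → length xs ≤ suc (length (filter ≢x₀? xs))
  length≤1+length-filter≢ {[]}     []               = z≤n
  length≤1+length-filter≢ {x ∷ xs} (x∉xs ∷ unique) with x ≟ x₀
  ... | yes refl =
    s≤s (≤-reflexive (sym (cong length (filter-all ≢x₀? (All.map (λ x₀≢y → x₀≢y ∘ sym) x∉xs)))))
  ... | no _     = s≤s (length≤1+length-filter≢ unique)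

  AtMost-insert : ∀ {P : A → Set} {b} → AtMost b P → AtMost (suc b) (λ x → x ≡ x₀ ⊎ P x)
  AtMost-insert {P} bound xs unique Pxs =
    ≤-trans (length≤1+length-filter≢ unique)
      (s≤s (bound _ (Unique.filter⁺ ≢x₀? unique)
                    (All.zipWith drop-x₀ (All.filter⁺ ≢x₀? Pxs , All.all-filter ≢x₀? xs))))
    where
    drop-x₀ : ∀ {x} → (x ≡ x₀ ⊎ P x) × x ≢ x₀ → P x
    drop-x₀ (inj₁ x≡x₀ , x≢x₀) = ⊥-elim (x≢x₀ x≡x₀)
    drop-x₀ (inj₂ Px   , _)    = Px

module _ {A : Set} where

  linked-∷ʳ⁺ : ∀ {R : A → A → Set} P {a b} → Linked R (P ∷ʳ a) → R a b → Linked R (P ∷ʳ a ∷ʳ b)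
  linked-∷ʳ⁺ []          [-]         Rab = Rab ∷ [-]
  linked-∷ʳ⁺ (_ ∷ [])    (Rxa ∷ [-]) Rab = Rxa ∷ Rab ∷ [-]
  linked-∷ʳ⁺ (_ ∷ y ∷ P) (Rxy ∷ Rys) Rab = Rxy ∷ linked-∷ʳ⁺ (y ∷ P) Rys Rab

  ∈-∷ʳ-++ : ∀ P {x : A} Q → x ∈ (P ∷ʳ x) ++ Q
  ∈-∷ʳ-++ P Q = ∈-++⁺ˡ (∈-++⁺ʳ P (here refl))

  grows⇒prefix : ∀ {C : ℕ → List A} → (∀ n → ∃ λ Q → C (suc n) ≡ C n ++ Q) →
    ∀ {m n} → m ≤ n → ∃ λ Q → C n ≡ C m ++ Q
  grows⇒prefix {C} grows {m} m≤n = go (≤⇒≤′ m≤n)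
    where
    go : ∀ {n} → m ≤′ n → ∃ λ Q → C n ≡ C m ++ Q
    go ≤′-refl = [] , sym (++-identityʳ (C m))
    go (≤′-step m≤′n) with go m≤′n | grows _
    ... | Q , eq | q , eq′ = Q ++ q , trans eq′ (trans (cong (_++ q) eq) (++-assoc (C m) Q q))

-- The walk, then its last vertex forever; d is only used for the empty walk.
pad : {A : Set} → A → List A → ℕ → A
pad d []       _       = d
pad d (x ∷ xs) zero    = x
pad d (x ∷ xs) (suc k) = pad x xs k

module _ {A : Set} where

  pad-linked : ∀ {R : A → A → Set} → Reflexive R →
    ∀ d {xs} → Linked R xs → ∀ k → R (pad d xs k) (pad d xs (suc k))
  pad-linked r d []          _       = r
  pad-linked r d [-]         zero    = r
  pad-linked r d [-]         (suc k) = r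
  pad-linked r d (Rxy ∷ _)   zero    = Rxy
  pad-linked r d (_ ∷ Rxs)   (suc k) = pad-linked r _ Rxs k

  applyUpTo-pad : ∀ (d : A) P Q → applyUpTo (pad d (P ++ Q)) (length P) ≡ P
  applyUpTo-pad d []      Q = refl
  applyUpTo-pad d (x ∷ P) Q = cong (x ∷_) (applyUpTo-pad x P Q)

  pad-length : ∀ (d : A) P x Q → pad d (P ++ x ∷ Q) (length P) ≡ x
  pad-length d []      x Q = refl
  pad-length d (y ∷ P) x Q = pad-length y P x Q

≟-V : (X : Graph) → DecidableEquality (V X)
≟-V X = inj⇒≟ (↔⇒↣ (↔-sym (enum X)))

DecidableAdjacency : Graph → Set
DecidableAdjacency X = ∀ u v → Dec (_~_ X u v)

¬¬-decidableAdjacency : (X : Graph) → ¬ ¬ DecidableAdjacency X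
¬¬-decidableAdjacency X =
  ¬¬-map on-vertices (¬¬-sequence λ i → ¬¬-sequence λ j → ¬¬-excluded-middle)
  where
  open Inverse (enum X)
  ¬¬-sequence : ∀ {n} {P : Fin n → Set} → (∀ i → ¬ ¬ P i) → ¬ ¬ (∀ i → P i)
  ¬¬-sequence = sequence (RawMonad.rawApplicative ¬¬-Monad)
  on-vertices : (∀ i j → Dec (_~_ X (to i) (to j))) → DecidableAdjacency X
  on-vertices adj? u v =
    subst₂ (λ u v → Dec (_~_ X u v)) (strictlyInverseˡ u) (strictlyInverseˡ v) (adj? (from u) (from v))

step? : (X : Graph) → DecidableAdjacency X → ∀ u v → Dec (Game.Step X u v)
step? X adj? u v = ≟-V X u v ⊎-dec adj? u v

module _ {X : Graph} where
  open Game X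

  Visited : RobberPlay → ℕ → V X → Set
  Visited ρ τ v = ∃ λ i → i ≤ τ × RobberPlay.pos ρ i ≡ v

  latest-damage : ∀ σ ρ {v vs} → All (Damaged σ ρ) (v ∷ vs) →
    ∃ λ τ → (∀ j → j ≤ τ → Safe σ ρ j) × All (Visited ρ τ) (v ∷ vs)
  latest-damage σ ρ ((i , rᵢ≡v , safe) ∷ []) = i , safe , (i , ≤-refl , rᵢ≡v) ∷ []
  latest-damage σ ρ ((i , rᵢ≡v , safe) ∷ damaged@(_ ∷ _)) with latest-damage σ ρ damaged
  ... | τ , safe-τ , visited with ≤-total i τ
  ...   | inj₁ i≤τ = τ , safe-τ , (i , i≤τ , rᵢ≡v) ∷ visited
  ...   | inj₂ τ≤i =
    i , safe , (i , ≤-refl , rᵢ≡v) ∷ All.map (λ (j , j≤τ , e) → j , ≤-trans j≤τ τ≤i , e) visited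

-- Cop strategies

record CopMachine (X : Graph) : Set₁ where
  field
    State    : Set
    start    : State
    read     : State → V X → State
    position : State → V X
    legal    : ∀ s x → Game.Step X (position s) (position (read s x))

module Machine {X : Graph} (M : CopMachine X) where
  open Game X
  open CopMachine M

  strategy : CopStrategy
  strategy = record
    { play  = position ∘ foldl read start
    ; legal = λ h x → subst (Step (position (foldl read start h)) ∘ position)
                            (sym (foldl-∷ʳ read start x h)) (legal (foldl read start h) x)
    }

  states : RobberPlay → ℕ → State
  states ρ zero    = start
  states ρ (suc n) = read (states ρ n) (RobberPlay.pos ρ n)

  cop≡position : ∀ ρ n → cop strategy ρ n ≡ position (states ρ n)
  cop≡position ρ n = cong position (foldl≡states n)
    where
    r : ℕ → V X
    r = RobberPlay.pos ρ
    foldl≡states : ∀ n → foldl read start (applyUpTo r n) ≡ states ρ n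
    foldl≡states zero    = refl
    foldl≡states (suc n) = begin
      foldl read start (applyUpTo r (suc n))         ≡⟨ cong (foldl read start) (applyUpTo-∷ʳ r n) ⟨
      foldl read start (applyUpTo r n ∷ʳ r n)        ≡⟨ foldl-∷ʳ read start (r n) (applyUpTo r n) ⟩
      read (foldl read start (applyUpTo r n)) (r n)  ≡⟨ cong (λ s → read s (r n)) (foldl≡states n) ⟩
      read (states ρ n) (r n)                        ∎
      where open ≡-Reasoning

-- Damage is only counted before the first capture, so every strategy can be made pursuing at no cost.
Pursuing : {X : Graph} → Game.CopStrategy X → Set
Pursuing {X} σ = ∀ ρ {k n} → ¬ Safe σ ρ k → k ≤ n → cop σ ρ (suc n) ≡ RobberPlay.pos ρ n
  where open Game X

module Pursuit {X : Graph} (adj? : DecidableAdjacency X) (σ : Game.CopStrategy X) where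
  open Game X
  open CopStrategy σ using (play)
  private
    _≟_ : DecidableEquality (V X)
    _≟_ = ≟-V X

  data Mode : Set where
    copying : List (V X) → Mode
    chasing : V X → Mode

  position : Mode → V X
  position (copying h) = play h
  position (chasing p) = p

  read : Mode → V X → Mode
  read (copying h) x with play h ≟ x | play (h ∷ʳ x) ≟ x
  ... | no _ | no _ = copying (h ∷ʳ x)
  ... | _    | _    = chasing x
  read (chasing p) x with step? X adj? p x
  ... | yes _ = chasing x
  ... | no _  = chasing p

  legal : ∀ m x → Step (position m) (position (read m x))
  legal (copying h) x with play h ≟ x | play (h ∷ʳ x) ≟ x
  ... | no _  | no _  = CopStrategy.legal σ h x
  ... | yes e | _     = inj₁ e
  ... | no _  | yes e = subst (Step (play h)) e (CopStrategy.legal σ h x)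
  legal (chasing p) x with step? X adj? p x
  ... | yes p→x = p→x
  ... | no _    = inj₁ refl

  machine : CopMachine X
  machine = record
    { State = Mode ; start = copying [] ; read = read ; position = position ; legal = legal }

  pursuit : CopStrategy
  pursuit = Machine.strategy machine

  read-copying : ∀ h x → (play h ≢ x × play (h ∷ʳ x) ≢ x × read (copying h) x ≡ copying (h ∷ʳ x))
                         ⊎ read (copying h) x ≡ chasing x
  read-copying h x with play h ≟ x | play (h ∷ʳ x) ≟ x
  ... | no h≢x | no hx≢x = inj₁ (h≢x , hx≢x , refl)
  ... | yes _  | _       = inj₂ refl
  ... | no _   | yes _   = inj₂ refl

  read-chasing : ∀ {p x} → Step p x → read (chasing p) x ≡ chasing x
  read-chasing {p} {x} p→x with step? X adj? p x
  ... | yes _   = refl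
  ... | no ¬p→x = ⊥-elim (¬p→x p→x)

  module _ (ρ : RobberPlay) where
    open RobberPlay ρ renaming (pos to r; legal to r-legal)

    mode : ℕ → Mode
    mode = Machine.states machine ρ

    cop-at : ∀ n {m} → mode n ≡ m → cop pursuit ρ n ≡ position m
    cop-at n eq = trans (Machine.cop≡position machine ρ n) (cong position eq)

    step-copying : ∀ n → mode n ≡ copying (applyUpTo r n) →
      (Safe pursuit ρ n × mode (suc n) ≡ copying (applyUpTo r (suc n))) ⊎ mode (suc n) ≡ chasing (r n)
    step-copying n eq with read-copying (applyUpTo r n) (r n)
    ... | inj₂ eq′ = inj₂ (trans (cong (λ m → read m (r n)) eq) eq′)
    ... | inj₁ (h≢r , hr≢r , eq′) =
      inj₁ ((h≢r ∘ trans (sym (cop-at n eq)) , hr≢r ∘ trans (sym (cop-at (suc n) next)))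
           , trans next (cong copying (applyUpTo-∷ʳ r n)))
      where
      next : mode (suc n) ≡ copying (applyUpTo r n ∷ʳ r n)
      next = trans (cong (λ m → read m (r n)) eq) eq′

    chase-on : ∀ n → mode (suc n) ≡ chasing (r n) → mode (suc (suc n)) ≡ chasing (r (suc n))
    chase-on n eq = trans (cong (λ m → read m (r (suc n))) eq) (read-chasing (r-legal n))

    copy-or-chase : ∀ n → (Safe pursuit ρ n × mode (suc n) ≡ copying (applyUpTo r (suc n)))
                          ⊎ mode (suc n) ≡ chasing (r n)
    copy-or-chase zero = step-copying zero refl
    copy-or-chase (suc n) with copy-or-chase n
    ... | inj₁ (_ , eq) = step-copying (suc n) eq
    ... | inj₂ eq       = inj₂ (chase-on n eq)

    safe⇒copying : ∀ n → (∀ j → j < n → Safe pursuit ρ j) → mode n ≡ copying (applyUpTo r n)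
    safe⇒copying zero    _    = refl
    safe⇒copying (suc n) safe with copy-or-chase n
    ... | inj₁ (_ , eq) = eq
    ... | inj₂ eq       = ⊥-elim (proj₂ (safe n ≤-refl) (cop-at (suc n) eq))

    unsafe⇒chasing : ∀ {k} → ¬ Safe pursuit ρ k → mode (suc k) ≡ chasing (r k)
    unsafe⇒chasing unsafe = [ ⊥-elim ∘ unsafe ∘ proj₁ , id ]′ (copy-or-chase _)

    chasing-after : ∀ {k n} → ¬ Safe pursuit ρ k → k ≤′ n → mode (suc n) ≡ chasing (r n)
    chasing-after unsafe ≤′-refl         = unsafe⇒chasing unsafe
    chasing-after unsafe (≤′-step k≤′n) = chase-on _ (chasing-after unsafe k≤′n)

    pursuit-damaged : ∀ {v} → Damaged pursuit ρ v → Damaged σ ρ v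
    pursuit-damaged (i , rᵢ≡v , safe) =
      i , rᵢ≡v , λ j j≤i → safe-σ (safe j j≤i) (m≤n⇒m≤1+n j≤i) (s≤s j≤i)
      where
      agree : ∀ {n} → n ≤ suc i → cop pursuit ρ n ≡ cop σ ρ n
      agree {n} n≤1+i = cop-at n (safe⇒copying n (λ j j<n → safe j (≤-pred (≤-trans j<n n≤1+i))))
      safe-σ : ∀ {j} → Safe pursuit ρ j → j ≤ suc i → suc j ≤ suc i → Safe σ ρ j
      safe-σ (s₁ , s₂) j≤ 1+j≤ = s₁ ∘ trans (agree j≤) , s₂ ∘ trans (agree 1+j≤)

  pursuit-pursuing : Pursuing pursuit
  pursuit-pursuing ρ {n = n} unsafe k≤n = cop-at ρ (suc n) (chasing-after ρ unsafe (≤⇒≤′ k≤n))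

pursuing-guarantee : ∀ {X k} → DecidableAdjacency X → Game.CopGuarantees X k →
  Σ (Game.CopStrategy X) λ σ → Pursuing σ × (∀ ρ → AtMost k (Game.Damaged X σ ρ))
pursuing-guarantee adj? (σ , bound) =
  pursuit , pursuit-pursuing ,
  λ ρ xs unique damaged → bound ρ xs unique (All.map (pursuit-damaged ρ) damaged)
  where open Pursuit adj? σ

module WalkShadow {X : Graph} (σ : Game.CopStrategy X) (pursuing : Pursuing σ) (d : V X)
                  {W : List (V X)} (walk : Linked (Game.Step X) W) where
  open Game X
  open CopStrategy σ using (play)
  private
    _≟_ : DecidableEquality (V X)
    _≟_ = ≟-V X

  ρ : RobberPlay
  ρ = record { pos = pad d W ; legal = pad-linked (inj₁ refl) d walk }

  safe? : ∀ k → Dec (Safe σ ρ k)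
  safe? k = ¬? (cop σ ρ k ≟ pad d W k) ×-dec ¬? (cop σ ρ (suc k) ≟ pad d W k)

  CaughtWithin : ℕ → Set
  CaughtWithin n = ∃ λ k → k < n × ¬ Safe σ ρ k

  caughtWithin? : ∀ n → Dec (CaughtWithin n)
  caughtWithin? = anyUpTo? (¬? ∘ safe?)

  uncaught-damaged : ∀ {x} → ¬ CaughtWithin (length W) → x ∈ W → Damaged σ ρ x
  uncaught-damaged {x} uncaught x∈W with ∈-∃++ x∈W
  ... | P , Q , refl = length P , pad-length d P x Q ,
          λ j j≤|P| → decidable-stable (safe? j) (λ unsafe → uncaught (j , j<|W| j≤|P| , unsafe))
    where
    j<|W| : ∀ {j} → j ≤ length P → j < length (P ++ x ∷ Q)
    j<|W| j≤|P| =
      subst (_ <_) (sym (length-++ P)) (<-≤-trans (s≤s j≤|P|) (m<m+n (length P) (s≤s z≤n)))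

  caught-captures : ∀ {P x} → W ≡ P ∷ʳ x → CaughtWithin (length W) → play W ≡ x
  caught-captures {P} {x} refl (k , k<|W| , unsafe) = begin
    play (P ∷ʳ x)
      ≡⟨ cong play (cong₂ _∷ʳ_ (applyUpTo-pad d P [ x ]) (pad-length d P x [])) ⟨
    play (applyUpTo (pad d W) n ∷ʳ pad d W n)
      ≡⟨ cong play (applyUpTo-∷ʳ (pad d W) n) ⟩
    cop σ ρ (suc n)
      ≡⟨ pursuing ρ unsafe k≤n ⟩
    pad d W n
      ≡⟨ pad-length d P x [] ⟩
    x ∎
    where
    open ≡-Reasoning
    n : ℕ
    n = length P
    k≤n : k ≤ n
    k≤n = ≤-pred (subst (k <_) (trans (length-++ P) (+-comm n 1)) k<|W|)

-- The Cartesian product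

-- All moves other than H-moves, passes included, are charged to the G-factor.
HMove : {A B : Set} → A × B → A × B → Set
HMove p x = proj₁ p ≡ proj₁ x × proj₂ p ≢ proj₂ x

module □-Step (G H : Graph) where
  open Game using (Step)

  step-G : ∀ {g g′ h} → Step G g g′ → Step (G □ H) (g , h) (g′ , h)
  step-G (inj₁ refl) = inj₁ refl
  step-G (inj₂ g~g′) = inj₂ (inj₂ (refl , g~g′))

  step-H : ∀ {g h h′} → Step H h h′ → Step (G □ H) (g , h) (g , h′)
  step-H (inj₁ refl) = inj₁ refl
  step-H (inj₂ h~h′) = inj₂ (inj₁ (refl , h~h′))

  HMove⇒step-H : ∀ {p x} → HMove p x → Step (G □ H) p x → Step H (proj₂ p) (proj₂ x)
  HMove⇒step-H (_ , h≢h′) (inj₁ refl)              = ⊥-elim (h≢h′ refl)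
  HMove⇒step-H _          (inj₂ (inj₁ (_ , h~h′))) = inj₂ h~h′
  HMove⇒step-H (_ , h≢h′) (inj₂ (inj₂ (h≡h′ , _))) = ⊥-elim (h≢h′ h≡h′)

  ¬HMove⇒step-G : ∀ {p x} → ¬ HMove p x → Step (G □ H) p x →
    Step G (proj₁ p) (proj₁ x) × proj₂ p ≡ proj₂ x
  ¬HMove⇒step-G _      (inj₁ refl)                 = inj₁ refl , refl
  ¬HMove⇒step-G ¬hmove (inj₂ (inj₁ (g≡g′ , h~h′))) =
    ⊥-elim (¬hmove (g≡g′ , λ { refl → ~-irr H h~h′ }))
  ¬HMove⇒step-G _      (inj₂ (inj₂ (h≡h′ , g~g′))) = inj₂ g~g′ , h≡h′

module Product {G H : Graph} (σG : Game.CopStrategy G) (σH : Game.CopStrategy H) where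
  open Game (G □ H)
  open □-Step G H
  open Game.CopStrategy σG using () renaming (play to playG)
  open Game.CopStrategy σH using () renaming (play to playH)

  -- The walks of the two shadow robbers; the H-walk starts empty, which is where dmg(H) + 1 comes from.
  record Traces : Set where
    constructor ⟨_,_,_⟩
    field
      previous : Maybe (V G × V H)
      gTrace   : List (V G)
      hTrace   : List (V H)
  open Traces

  hmove? : ∀ p x → Dec (HMove p x)
  hmove? p x = ≟-V G (proj₁ p) (proj₁ x) ×-dec ¬? (≟-V H (proj₂ p) (proj₂ x))

  read : Traces → V G × V H → Traces
  read ⟨ nothing , c , h ⟩ x = ⟨ just x , c ∷ʳ proj₁ x , h ⟩
  read ⟨ just p  , c , h ⟩ x with hmove? p x
  ... | yes _ = ⟨ just x , c , h ∷ʳ proj₂ x ⟩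
  ... | no _  = ⟨ just x , c ∷ʳ proj₁ x , h ⟩

  position : Traces → V G × V H
  position s = playG (gTrace s) , playH (hTrace s)

  legal : ∀ s x → Step (position s) (position (read s x))
  legal ⟨ nothing , c , h ⟩ x = step-G (Game.CopStrategy.legal σG c (proj₁ x))
  legal ⟨ just p  , c , h ⟩ x with hmove? p x
  ... | yes _ = step-H (Game.CopStrategy.legal σH h (proj₂ x))
  ... | no _  = step-G (Game.CopStrategy.legal σG c (proj₁ x))

  machine : CopMachine (G □ H)
  machine = record
    { State = Traces ; start = ⟨ nothing , [] , [] ⟩ ; read = read ; position = position ; legal = legal }

  strategy : CopStrategy
  strategy = Machine.strategy machine

  previous-read : ∀ s x → previous (read s x) ≡ just x
  previous-read ⟨ nothing , _ , _ ⟩ x = refl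
  previous-read ⟨ just p  , _ , _ ⟩ x with hmove? p x
  ... | yes _ = refl
  ... | no _  = refl

  data Records (p x : V G × V H) (s s′ : Traces) : Set where
    g-move : ¬ HMove p x → gTrace s′ ≡ gTrace s ∷ʳ proj₁ x → hTrace s′ ≡ hTrace s →
             Records p x s s′
    h-move : HMove p x → gTrace s′ ≡ gTrace s → hTrace s′ ≡ hTrace s ∷ʳ proj₂ x →
             Records p x s s′

  read-records : ∀ {s p} x → previous s ≡ just p → Records p x s (read s x)
  read-records {⟨ just p , _ , _ ⟩} x refl with hmove? p x
  ... | yes hmove = h-move hmove refl refl
  ... | no ¬hmove = g-move ¬hmove refl refl

  module Run (ρ : RobberPlay) where
    open RobberPlay ρ renaming (pos to r; legal to r-legal)

    rG : ℕ → V G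
    rG = proj₁ ∘ r

    rH : ℕ → V H
    rH = proj₂ ∘ r

    traces : ℕ → Traces
    traces = Machine.states machine ρ

    CG : ℕ → List (V G)
    CG = gTrace ∘ traces

    CH : ℕ → List (V H)
    CH = hTrace ∘ traces

    record-move : ∀ m → Records (r m) (r (suc m)) (traces (suc m)) (traces (suc (suc m)))
    record-move m = read-records (r (suc m)) (previous-read (traces m) (r m))

    gTrace-grows : ∀ n → ∃ λ Q → CG (suc n) ≡ CG n ++ Q
    gTrace-grows zero = [ rG 0 ] , refl
    gTrace-grows (suc m) with record-move m
    ... | g-move _ eq _ = [ rG (suc m) ] , eq
    ... | h-move _ eq _ = [] , trans eq (sym (++-identityʳ _))

    hTrace-grows : ∀ n → ∃ λ Q → CH (suc n) ≡ CH n ++ Q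
    hTrace-grows zero = [] , refl
    hTrace-grows (suc m) with record-move m
    ... | g-move _ _ eq = [] , trans eq (sym (++-identityʳ _))
    ... | h-move _ _ eq = [ rH (suc m) ] , eq

    gTrace-last : ∀ n → ∃ λ P → CG (suc n) ≡ P ∷ʳ rG n
    gTrace-last zero = [] , refl
    gTrace-last (suc m) with record-move m | gTrace-last m
    ... | g-move _ eq _          | _       = CG (suc m) , eq
    ... | h-move (same , _) eq _ | P , eq′ = P , trans eq (trans eq′ (cong (P ∷ʳ_) same))

    hTrace-last : ∀ n → (CH (suc n) ≡ [] × rH n ≡ rH 0) ⊎ ∃ λ P → CH (suc n) ≡ P ∷ʳ rH n
    hTrace-last zero = inj₁ (refl , refl)
    hTrace-last (suc m) with record-move m
    ... | h-move _ _ eq = inj₂ (CH (suc m) , eq)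
    ... | g-move ¬hmove _ eq with proj₂ (¬HMove⇒step-G ¬hmove (r-legal m)) | hTrace-last m
    ...   | same | inj₁ (eq′ , rₘ≡r₀) = inj₁ (trans eq eq′ , trans (sym same) rₘ≡r₀)
    ...   | same | inj₂ (P , eq′)     = inj₂ (P , trans eq (trans eq′ (cong (P ∷ʳ_) same)))

    gTrace-walk : ∀ n → Linked (Game.Step G) (CG n)
    gTrace-walk zero          = []
    gTrace-walk (suc zero)    = [-]
    gTrace-walk (suc (suc m)) with record-move m | gTrace-last m | gTrace-walk (suc m)
    ... | h-move _ eq _      | _       | walk = subst (Linked _) (sym eq) walk
    ... | g-move ¬hmove eq _ | P , eq′ | walk =
      subst (Linked _) (sym (trans eq (cong (_∷ʳ rG (suc m)) eq′)))
        (linked-∷ʳ⁺ P (subst (Linked _) eq′ walk) (proj₁ (¬HMove⇒step-G ¬hmove (r-legal m))))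

    hTrace-walk : ∀ n → Linked (Game.Step H) (CH n)
    hTrace-walk zero          = []
    hTrace-walk (suc zero)    = []
    hTrace-walk (suc (suc m)) with record-move m | hTrace-last m | hTrace-walk (suc m)
    ... | g-move _ _ eq     | _              | walk = subst (Linked _) (sym eq) walk
    ... | h-move _ _ eq     | inj₁ (eq′ , _) | _    =
      subst (Linked _) (sym (trans eq (cong (_∷ʳ rH (suc m)) eq′))) [-]
    ... | h-move hmove _ eq | inj₂ (P , eq′) | walk =
      subst (Linked _) (sym (trans eq (cong (_∷ʳ rH (suc m)) eq′)))
        (linked-∷ʳ⁺ P (subst (Linked _) eq′ walk) (HMove⇒step-H hmove (r-legal m)))

    rG∈gTrace : ∀ {i n} → i ≤ n → rG i ∈ CG (suc n)
    rG∈gTrace {i} i≤n with grows⇒prefix gTrace-grows (s≤s i≤n) | gTrace-last i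
    ... | Q , eq | P , eq′ = subst (rG i ∈_) (sym (trans eq (cong (_++ Q) eq′))) (∈-∷ʳ-++ P Q)

    rH∈hTrace : ∀ {i n} → i ≤ n → rH i ≡ rH 0 ⊎ rH i ∈ CH (suc n)
    rH∈hTrace {i} i≤n with grows⇒prefix hTrace-grows (s≤s i≤n) | hTrace-last i
    ... | _ , _  | inj₁ (_ , rᵢ≡r₀) = inj₁ rᵢ≡r₀
    ... | Q , eq | inj₂ (P , eq′)   =
      inj₂ (subst (rH i ∈_) (sym (trans eq (cong (_++ Q) eq′))) (∈-∷ʳ-++ P Q))

    module Horizon (pursuingG : Pursuing σG) (pursuingH : Pursuing σH) (τ : ℕ) where
      module SG = WalkShadow σG pursuingG (rG 0) (gTrace-walk (suc τ))
      module SH = WalkShadow σH pursuingH (rH 0) (hTrace-walk (suc τ))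

      caught-in-both : SG.CaughtWithin (length (CG (suc τ))) → SH.CaughtWithin (length (CH (suc τ))) →
        cop strategy ρ (suc τ) ≡ r τ
      caught-in-both caughtG caughtH =
        trans (Machine.cop≡position machine ρ (suc τ))
              (cong₂ _,_ (SG.caught-captures (proj₂ (gTrace-last τ)) caughtG) (atH caughtH))
        where
        atH : SH.CaughtWithin (length (CH (suc τ))) → playH (CH (suc τ)) ≡ rH τ
        atH caughtH@(k , k<|CH| , _) with hTrace-last τ
        ... | inj₁ (eq , _) = ⊥-elim (n≮0 (subst (k <_) (cong length eq) k<|CH|))
        ... | inj₂ (_ , eq) = SH.caught-captures eq caughtH

      visited-bound : ∀ {a b} →
        (∀ ρ′ → AtMost a (Game.Damaged G σG ρ′)) → (∀ ρ′ → AtMost b (Game.Damaged H σH ρ′)) →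
        (∀ j → j ≤ τ → Safe strategy ρ j) → AtMost ((a * order H) ⊔ (suc b * order G)) (Visited ρ τ)
      visited-bound boundG boundH safe vs unique visited with SG.caughtWithin? (length (CG (suc τ)))
      ... | no uncaughtG =
        ≤-trans (AtMost-proj₁ (≟-V G) (enum H) (boundG SG.ρ) vs unique (All.map g-damaged visited))
                (m≤m⊔n _ _)
        where
        g-damaged : ∀ {v} → Visited ρ τ v → Game.Damaged G σG SG.ρ (proj₁ v)
        g-damaged (i , i≤τ , refl) = SG.uncaught-damaged uncaughtG (rG∈gTrace i≤τ)
      ... | yes caughtG =
        ≤-trans (AtMost-proj₂ (≟-V H) (enum G) (AtMost-insert (≟-V H) (rH 0) (boundH SH.ρ)) vs unique
                              (All.map h-damaged visited))
                (m≤n⊔m _ _)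
        where
        uncaughtH : ¬ SH.CaughtWithin (length (CH (suc τ)))
        uncaughtH caughtH = proj₂ (safe τ ≤-refl) (caught-in-both caughtG caughtH)
        h-damaged : ∀ {v} → Visited ρ τ v → proj₂ v ≡ rH 0 ⊎ Game.Damaged H σH SH.ρ (proj₂ v)
        h-damaged (i , i≤τ , refl) = Sum.map₂ (SH.uncaught-damaged uncaughtH) (rH∈hTrace i≤τ)

  damage-bound : Pursuing σG → Pursuing σH → ∀ {a b} →
    (∀ ρ → AtMost a (Game.Damaged G σG ρ)) → (∀ ρ → AtMost b (Game.Damaged H σH ρ)) →
    ∀ ρ → AtMost ((a * order H) ⊔ (suc b * order G)) (Damaged strategy ρ)
  damage-bound _ _ _ _ ρ [] _ _ = z≤n
  damage-bound pursuingG pursuingH boundG boundH ρ vs@(_ ∷ _) unique damaged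
    with latest-damage strategy ρ damaged
  ... | τ , safe , visited =
    Run.Horizon.visited-bound ρ pursuingG pursuingH τ boundG boundH safe vs unique visited

product-guarantee : ∀ {G H a b} → DecidableAdjacency G → DecidableAdjacency H →
  Game.CopGuarantees G a → Game.CopGuarantees H b →
  Game.CopGuarantees (G □ H) ((a * order H) ⊔ (suc b * order G))
product-guarantee adjG? adjH? guaranteeG guaranteeH
  with pursuing-guarantee adjG? guaranteeG | pursuing-guarantee adjH? guaranteeH
... | σG , pursuingG , boundG | σH , pursuingH , boundH =
  Product.strategy σG σH , Product.damage-bound σG σH pursuingG pursuingH boundG boundH

corollary11 : (G H : Graph) → Connected G → Connected H →
    (a b d : ℕ) → IsDmg G a → IsDmg H b → IsDmg (G □ H) d →
    d ≤ (a * order H) ⊔ (suc b * order G)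
corollary11 G H _ _ a b d (guaranteeG , _) (guaranteeH , _) (_ , least) =
  decidable-stable (d ≤? _) λ d≰ →
    ¬¬-decidableAdjacency G λ adjG? →
    ¬¬-decidableAdjacency H λ adjH? →
    d≰ (least _ (product-guarantee adjG? adjH? guaranteeG guaranteeH))
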